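{- Let $A$ be a normal Wajsberg pseudo-hoop. Then ${\rm Inv}(A)$ is a subalgebra of $A$; in particular, for all $x,y\in{\rm Inv}(A)$, the elements $x\odot y$, $x\rightarrow y$, $x\rightsquigarrow y$, $x\wedge y$ and $x\vee y$ belong to ${\rm Inv}(A)$.
   Context: A pseudo-hoop is an algebra $(A,\odot,\rightarrow,\rightsquigarrow,1)$ of type $(2,2,2,0)$ such that for all $x,y,z\in A$: $x\odot 1=1\odot x=x$; $x\rightarrow x=x\rightsquigarrow x=1$; $(x\odot y)\rightarrow z=x\rightarrow(y\rightarrow z)$; $(x\odot y)\rightsquigarrow z=y\rightsquigarrow(x\rightsquigarrow z)$; $(x\rightarrow y)\odot x=(y\rightarrow x)\odot y=x\odot(x\rightsquigarrow y)=y\odot(y\rightsquigarrow x)$. The order is $x\le y$ iff $x\rightarrow y=1$; $x\wedge y=(x\rightarrow y)\odot x$. It is bounded if it has a least element $0$; then $x^-=x\rightarrow 0$, $x^\sim=x\rightsquigarrow 0$, $x^{ -\sim}=(x^-)^\sim$, $x^{\sim- }=(x^\sim)^-$. ${\rm Inv}(A)=\{x\in A\mid x^{ -\sim}=x^{\sim- }=x\}$. Put $x\vee_1 y=(x\rightarrow y)\rightsquigarrow y$, $x\vee_2 y=(x\rightsquigarrow y)\rightarrow y$; $A$ is Wajsberg if $x\vee_1 y=y\vee_1 x$ and $x\vee_2 y=y\vee_2 x$ for all $x,y$; then $(A,\le)$ is a lattice with $x\vee y=x\vee_1 y=x\vee_2 y$. A bounded pseudo-hoop is normal if $(x\odot y)^{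 -\sim}=x^{ -\sim}\odot y^{ -\sim}$ and $(x\odot y)^{\sim- }=x^{\sim- }\odot y^{\sim- }$ for all $x,y$. -}

module Defs where

open import Level using (Level; suc; _⊔_)
open import Relation.Binary.PropositionalEquality using (_≡_)
open import Data.Product using (_×_)

record PseudoHoop (a : Level) : Set (suc a) where
  infixl 7 _⊙_
  infixr 5 _⇒_ _⇝_
  field
    Carrier : Set a
    _⊙_ : Carrier → Carrier → Carrier
    _⇒_ : Carrier → Carrier → Carrier
    _⇝_ : Carrier → Carrier → Carrier
    𝟙   : Carrier
    ⊙-identityʳ : ∀ x → x ⊙ 𝟙 ≡ x
    ⊙-identityˡ : ∀ x → 𝟙 ⊙ x ≡ x
    ⇒-refl : ∀ x → x ⇒ x ≡ 𝟙
    ⇝-refl : ∀ x → x ⇝ x ≡ 𝟙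
    ⊙-⇒ : ∀ x y z → (x ⊙ y) ⇒ z ≡ x ⇒ (y ⇒ z)
    ⊙-⇝ : ∀ x y z → (x ⊙ y) ⇝ z ≡ y ⇝ (x ⇝ z)
    div₁ : ∀ x y → (x ⇒ y) ⊙ x ≡ (y ⇒ x) ⊙ y
    div₂ : ∀ x y → (y ⇒ x) ⊙ y ≡ x ⊙ (x ⇝ y)
    div₃ : ∀ x y → x ⊙ (x ⇝ y) ≡ y ⊙ (y ⇝ x)

  _≤_ : Carrier → Carrier → Set a
  x ≤ y = (x ⇒ y) ≡ 𝟙

  _∧_ : Carrier → Carrier → Carrier
  x ∧ y = (x ⇒ y) ⊙ x

  _∨₁_ : Carrier → Carrier → Carrier
  x ∨₁ y = (x ⇒ y) ⇝ y

  _∨₂_ : Carrier → Carrier → Carrier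
  x ∨₂ y = (x ⇝ y) ⇒ y

  IsWajsberg : Set a
  IsWajsberg = (∀ x y → x ∨₁ y ≡ y ∨₁ x) × (∀ x y → x ∨₂ y ≡ y ∨₂ x)

record BoundedPseudoHoop (a : Level) : Set (suc a) where
  field
    pseudoHoop : PseudoHoop a
  open PseudoHoop pseudoHoop public
  field
    𝟘 : Carrier
    𝟘-least : ∀ x → 𝟘 ≤ x

  _⁻ : Carrier → Carrier
  x ⁻ = x ⇒ 𝟘

  _˜ : Carrier → Carrier
  x ˜ = x ⇝ 𝟘

  _⁻˜ : Carrier → Carrier
  x ⁻˜ = (x ⁻) ˜

  _˜⁻ : Carrier → Carrier
  x ˜⁻ = (x ˜) ⁻

  Inv : Carrier → Set a
  Inv x = (x ⁻˜ ≡ x) × (x ˜⁻ ≡ x)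

  IsNormal : Set a
  IsNormal = (∀ x y → (x ⊙ y) ⁻˜ ≡ (x ⁻˜) ⊙ (y ⁻˜))
           × (∀ x y → (x ⊙ y) ˜⁻ ≡ (x ˜⁻) ⊙ (y ˜⁻))

  -- In a Wajsberg pseudo-hoop x ∨ y = x ∨₁ y (= x ∨₂ y).
  _∨_ : Carrier → Carrier → Carrier
  x ∨ y = x ∨₁ y

-- In a bounded pseudo-hoop both double negations x ↦ x⁻˜ and x ↦ x˜⁻ are inflationary and
-- monotone, and normality says exactly that they are multiplicative. For any such operator c
-- the fixed points are closed under ⊙ trivially, and under ⇒ by residuation: if c x = x and
-- c y = y, then c (x ⇒ y) ⊙ x = c ((x ⇒ y) ⊙ x) ≤ c y = y, whence c (x ⇒ y) ≤ x ⇒ y; dually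
-- for ⇝. Inv(A) is the common fixed-point set of the two operators, and x ∧ y, x ∨ y are
-- composed from ⊙, ⇒ and ⇝.
module Submission where

open import Defs
open import Level using (Level)
open import Data.Product using (_×_; _,_; proj₁; proj₂)
open import Relation.Binary.PropositionalEquality
open ≡-Reasoning

module PseudoHoopProperties {a : Level} (A : PseudoHoop a) where
  open PseudoHoop A

  ∧-comm : ∀ x y → x ∧ y ≡ y ∧ x
  ∧-comm = div₁

  ∧-⇝ : ∀ x y → x ∧ y ≡ x ⊙ (x ⇝ y)
  ∧-⇝ x y = trans (div₁ x y) (div₂ x y)

  x≤y⇒x∧y≡x : ∀ {x y} → x ≤ y → x ∧ y ≡ x
  x≤y⇒x∧y≡x {x} p = trans (cong (_⊙ x) p) (⊙-identityˡ x)

  ≤-antisym : ∀ {x y} → x ≤ y → y ≤ x → x ≡ y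
  ≤-antisym {x} {y} p q = begin
    x      ≡⟨ sym (x≤y⇒x∧y≡x p) ⟩
    x ∧ y  ≡⟨ ∧-comm x y ⟩
    y ∧ x  ≡⟨ x≤y⇒x∧y≡x q ⟩
    y      ∎

  ⇒-identityˡ-⇒ : ∀ x y → 𝟙 ⇒ (x ⇒ y) ≡ x ⇒ y
  ⇒-identityˡ-⇒ x y = trans (sym (⊙-⇒ 𝟙 x y)) (cong (_⇒ y) (⊙-identityˡ x))

  𝟙⇒x≡[x⇒𝟙]⊙x : ∀ x → 𝟙 ⇒ x ≡ (x ⇒ 𝟙) ⊙ x
  𝟙⇒x≡[x⇒𝟙]⊙x x = trans (sym (⊙-identityʳ (𝟙 ⇒ x))) (sym (div₁ x 𝟙))

  [𝟙⇒x]⇒y≡[x⇒𝟙]⇒x⇒y : ∀ x y → (𝟙 ⇒ x) ⇒ y ≡ (x ⇒ 𝟙) ⇒ (x ⇒ y)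
  [𝟙⇒x]⇒y≡[x⇒𝟙]⇒x⇒y x y = trans (cong (_⇒ y) (𝟙⇒x≡[x⇒𝟙]⊙x x)) (⊙-⇒ (x ⇒ 𝟙) x y)

  𝟙⇒x≤𝟙 : ∀ x → (𝟙 ⇒ x) ≤ 𝟙
  𝟙⇒x≤𝟙 x = trans ([𝟙⇒x]⇒y≡[x⇒𝟙]⇒x⇒y x 𝟙) (⇒-refl (x ⇒ 𝟙))

  x⇒y≤𝟙 : ∀ x y → (x ⇒ y) ≤ 𝟙
  x⇒y≤𝟙 x y = subst (_≤ 𝟙) (⇒-identityˡ-⇒ x y) (𝟙⇒x≤𝟙 (x ⇒ y))

  ⇒-identityˡ : ∀ x → 𝟙 ⇒ x ≡ x
  ⇒-identityˡ x = ≤-antisym 𝟙⇒x≤x x≤𝟙⇒x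
    where
    𝟙⇒x≤x : (𝟙 ⇒ x) ≤ x
    𝟙⇒x≤x = begin
      (𝟙 ⇒ x) ⇒ x        ≡⟨ [𝟙⇒x]⇒y≡[x⇒𝟙]⇒x⇒y x x ⟩
      (x ⇒ 𝟙) ⇒ (x ⇒ x)  ≡⟨ cong ((x ⇒ 𝟙) ⇒_) (⇒-refl x) ⟩
      (x ⇒ 𝟙) ⇒ 𝟙        ≡⟨ x⇒y≤𝟙 x 𝟙 ⟩
      𝟙                  ∎
    x≤𝟙⇒x : x ≤ (𝟙 ⇒ x)
    x≤𝟙⇒x = trans (sym (⊙-⇒ x 𝟙 x)) (trans (cong (_⇒ x) (⊙-identityʳ x)) (⇒-refl x))

  x≤𝟙 : ∀ x → x ≤ 𝟙
  x≤𝟙 x = subst (_≤ 𝟙) (⇒-identityˡ x) (𝟙⇒x≤𝟙 x)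

  ⇝-identityˡ : ∀ x → 𝟙 ⇝ x ≡ x
  ⇝-identityˡ x = begin
    𝟙 ⇝ x            ≡⟨ sym (⊙-identityˡ (𝟙 ⇝ x)) ⟩
    𝟙 ⊙ (𝟙 ⇝ x)      ≡⟨ sym (div₂ 𝟙 x) ⟩
    (x ⇒ 𝟙) ⊙ x      ≡⟨ cong (_⊙ x) (x≤𝟙 x) ⟩
    𝟙 ⊙ x            ≡⟨ ⊙-identityˡ x ⟩
    x                ∎

  ≤⇒⇝≡𝟙 : ∀ {x y} → x ≤ y → x ⇝ y ≡ 𝟙
  ≤⇒⇝≡𝟙 {x} {y} p = begin
    x ⇝ y                  ≡⟨ cong (_⇝ y) x≡x⊙[x⇝y] ⟩
    (x ⊙ (x ⇝ y)) ⇝ y      ≡⟨ ⊙-⇝ x (x ⇝ y) y ⟩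
    (x ⇝ y) ⇝ (x ⇝ y)      ≡⟨ ⇝-refl (x ⇝ y) ⟩
    𝟙                      ∎
    where
    x≡x⊙[x⇝y] : x ≡ x ⊙ (x ⇝ y)
    x≡x⊙[x⇝y] = trans (sym (x≤y⇒x∧y≡x p)) (∧-⇝ x y)

  ⇝≡𝟙⇒≤ : ∀ {x y} → x ⇝ y ≡ 𝟙 → x ≤ y
  ⇝≡𝟙⇒≤ {x} {y} p = begin
    x ⇒ y                  ≡⟨ cong (_⇒ y) x≡y∧x ⟩
    ((y ⇒ x) ⊙ y) ⇒ y      ≡⟨ ⊙-⇒ (y ⇒ x) y y ⟩
    (y ⇒ x) ⇒ (y ⇒ y)      ≡⟨ cong ((y ⇒ x) ⇒_) (⇒-refl y) ⟩
    (y ⇒ x) ⇒ 𝟙            ≡⟨ x≤𝟙 (y ⇒ x) ⟩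
    𝟙                      ∎
    where
    x≡y∧x : x ≡ y ∧ x
    x≡y∧x = sym (trans (div₂ x y) (trans (cong (x ⊙_) p) (⊙-identityʳ x)))

  x⊙y≤x : ∀ x y → (x ⊙ y) ≤ x
  x⊙y≤x x y = ⇝≡𝟙⇒≤ (trans (⊙-⇝ x y x) (trans (cong (y ⇝_) (⇝-refl x)) (≤⇒⇝≡𝟙 (x≤𝟙 y))))

  x⊙y≤y : ∀ x y → (x ⊙ y) ≤ y
  x⊙y≤y x y = trans (⊙-⇒ x y y) (trans (cong (x ⇒_) (⇒-refl y)) (x≤𝟙 x))

  ⇒-mp : ∀ x y → ((x ⇒ y) ⊙ x) ≤ y
  ⇒-mp x y = trans (⊙-⇒ (x ⇒ y) x y) (⇒-refl (x ⇒ y))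

  ⇝-mp : ∀ x y → (x ⊙ (x ⇝ y)) ≤ y
  ⇝-mp x y = ⇝≡𝟙⇒≤ (trans (⊙-⇝ x (x ⇝ y) y) (⇝-refl (x ⇝ y)))

  ⊙-residualʳ : ∀ {x y z} → (x ⊙ y) ≤ z → x ≤ (y ⇒ z)
  ⊙-residualʳ {x} {y} {z} p = trans (sym (⊙-⇒ x y z)) p

  ⊙-residualˡ : ∀ {x y z} → (y ⊙ x) ≤ z → x ≤ (y ⇝ z)
  ⊙-residualˡ {x} {y} {z} p = ⇝≡𝟙⇒≤ (trans (sym (⊙-⇝ y x z)) (≤⇒⇝≡𝟙 p))

  ⇒-antitoneˡ : ∀ {x y} z → x ≤ y → (y ⇒ z) ≤ (x ⇒ z)
  ⇒-antitoneˡ {x} {y} z p =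
    subst ((y ⇒ z) ≤_) [y⇒x]⇒y⇒z≡x⇒z (⊙-residualʳ (x⊙y≤x (y ⇒ z) (y ⇒ x)))
    where
    [y⇒x]⇒y⇒z≡x⇒z : (y ⇒ x) ⇒ (y ⇒ z) ≡ x ⇒ z
    [y⇒x]⇒y⇒z≡x⇒z = begin
      (y ⇒ x) ⇒ (y ⇒ z)  ≡⟨ sym (⊙-⇒ (y ⇒ x) y z) ⟩
      (y ∧ x) ⇒ z        ≡⟨ cong (_⇒ z) (trans (∧-comm y x) (x≤y⇒x∧y≡x p)) ⟩
      x ⇒ z              ∎

  ⇝-antitoneˡ : ∀ {x y} z → x ≤ y → (y ⇝ z) ≤ (x ⇝ z)
  ⇝-antitoneˡ {x} {y} z p =
    subst ((y ⇝ z) ≤_) [y⇝x]⇝y⇝z≡x⇝z (⊙-residualˡ (x⊙y≤y (y ⇝ x) (y ⇝ z)))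
    where
    [y⇝x]⇝y⇝z≡x⇝z : (y ⇝ x) ⇝ (y ⇝ z) ≡ x ⇝ z
    [y⇝x]⇝y⇝z≡x⇝z = begin
      (y ⇝ x) ⇝ (y ⇝ z)  ≡⟨ sym (⊙-⇝ y (y ⇝ x) z) ⟩
      (y ⊙ (y ⇝ x)) ⇝ z  ≡⟨ cong (_⇝ z) (trans (sym (∧-⇝ y x)) (trans (∧-comm y x) (x≤y⇒x∧y≡x p))) ⟩
      x ⇝ z              ∎

  module FixedPoints
    (c : Carrier → Carrier)
    (c-inflationary : ∀ x → x ≤ c x)
    (c-monotone : ∀ {x y} → x ≤ y → c x ≤ c y)
    (c-⊙ : ∀ x y → c (x ⊙ y) ≡ c x ⊙ c y)
    where

    fixed-⊙ : ∀ {x y} → c x ≡ x → c y ≡ y → c (x ⊙ y) ≡ x ⊙ y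
    fixed-⊙ {x} {y} cx cy = trans (c-⊙ x y) (cong₂ _⊙_ cx cy)

    fixed-⇒ : ∀ {x y} → c x ≡ x → c y ≡ y → c (x ⇒ y) ≡ x ⇒ y
    fixed-⇒ {x} {y} cx cy = ≤-antisym (⊙-residualʳ c[x⇒y]⊙x≤y) (c-inflationary (x ⇒ y))
      where
      c[x⇒y]⊙x≤y : (c (x ⇒ y) ⊙ x) ≤ y
      c[x⇒y]⊙x≤y =
        subst₂ _≤_ (trans (c-⊙ (x ⇒ y) x) (cong (c (x ⇒ y) ⊙_) cx)) cy (c-monotone (⇒-mp x y))

    fixed-⇝ : ∀ {x y} → c x ≡ x → c y ≡ y → c (x ⇝ y) ≡ x ⇝ y
    fixed-⇝ {x} {y} cx cy = ≤-antisym (⊙-residualˡ x⊙c[x⇝y]≤y) (c-inflationary (x ⇝ y))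
      where
      x⊙c[x⇝y]≤y : (x ⊙ c (x ⇝ y)) ≤ y
      x⊙c[x⇝y]≤y =
        subst₂ _≤_ (trans (c-⊙ x (x ⇝ y)) (cong (_⊙ c (x ⇝ y)) cx)) cy (c-monotone (⇝-mp x y))

module BoundedPseudoHoopProperties {a : Level} (A : BoundedPseudoHoop a) where
  open BoundedPseudoHoop A
  open PseudoHoopProperties pseudoHoop public

  x≤x⁻˜ : ∀ x → x ≤ (x ⁻˜)
  x≤x⁻˜ x = ⊙-residualˡ (⇒-mp x 𝟘)

  x≤x˜⁻ : ∀ x → x ≤ (x ˜⁻)
  x≤x˜⁻ x = ⊙-residualʳ (⇝-mp x 𝟘)

  ⁻˜-monotone : ∀ {x y} → x ≤ y → (x ⁻˜) ≤ (y ⁻˜)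
  ⁻˜-monotone p = ⇝-antitoneˡ 𝟘 (⇒-antitoneˡ 𝟘 p)

  ˜⁻-monotone : ∀ {x y} → x ≤ y → (x ˜⁻) ≤ (y ˜⁻)
  ˜⁻-monotone p = ⇒-antitoneˡ 𝟘 (⇝-antitoneˡ 𝟘 p)

  Inv-𝟘 : Inv 𝟘
  Inv-𝟘 = trans (cong (_⇝ 𝟘) (⇒-refl 𝟘)) (⇝-identityˡ 𝟘)
        , trans (cong (_⇒ 𝟘) (⇝-refl 𝟘)) (⇒-identityˡ 𝟘)

  Inv-𝟙 : Inv 𝟙
  Inv-𝟙 = trans (cong (_⇝ 𝟘) (⇒-identityˡ 𝟘)) (⇝-refl 𝟘)
        , trans (cong (_⇒ 𝟘) (⇝-identityˡ 𝟘)) (⇒-refl 𝟘)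

  module InvClosure (normal : IsNormal) where
    private
      module ⁻˜ = FixedPoints _⁻˜ x≤x⁻˜ ⁻˜-monotone (proj₁ normal)
      module ˜⁻ = FixedPoints _˜⁻ x≤x˜⁻ ˜⁻-monotone (proj₂ normal)

    Inv-⊙ : ∀ {x y} → Inv x → Inv y → Inv (x ⊙ y)
    Inv-⊙ (x⁻˜ , x˜⁻) (y⁻˜ , y˜⁻) = ⁻˜.fixed-⊙ x⁻˜ y⁻˜ , ˜⁻.fixed-⊙ x˜⁻ y˜⁻

    Inv-⇒ : ∀ {x y} → Inv x → Inv y → Inv (x ⇒ y)
    Inv-⇒ (x⁻˜ , x˜⁻) (y⁻˜ , y˜⁻) = ⁻˜.fixed-⇒ x⁻˜ y⁻˜ , ˜⁻.fixed-⇒ x˜⁻ y˜⁻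

    Inv-⇝ : ∀ {x y} → Inv x → Inv y → Inv (x ⇝ y)
    Inv-⇝ (x⁻˜ , x˜⁻) (y⁻˜ , y˜⁻) = ⁻˜.fixed-⇝ x⁻˜ y⁻˜ , ˜⁻.fixed-⇝ x˜⁻ y˜⁻

proposition3p17 : {a : Level} (A : BoundedPseudoHoop a) →
    let open BoundedPseudoHoop A in
    IsWajsberg → IsNormal →
    Inv 𝟘 × Inv 𝟙 ×
    (∀ x y → Inv x → Inv y →
      Inv (x ⊙ y) × Inv (x ⇒ y) × Inv (x ⇝ y) × Inv (x ∧ y) × Inv (x ∨ y))
proposition3p17 A _ normal = Inv-𝟘 , Inv-𝟙 , λ x y x∈Inv y∈Inv →
  let x⇒y∈Inv = Inv-⇒ x∈Inv y∈Inv
  in Inv-⊙ x∈Inv y∈Inv , x⇒y∈Inv , Inv-⇝ x∈Inv y∈Inv ,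
     Inv-⊙ x⇒y∈Inv x∈Inv , Inv-⇝ x⇒y∈Inv y∈Inv
  where
  open BoundedPseudoHoopProperties A
  open InvClosure normal
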